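{- If $A$ is a closed $\forall^+$ type of System $\mathcal F$, then $A$ is an input type, i.e. every $\beta$-normal $\lambda$-term $t$ with $\vdash_{\mathcal F} t:A$ satisfies $\vdash_{\mathcal F_0} t:A$.
   Context: System $\mathcal F$: types are built from type variables (and type constants) with $\rightarrow$ and $\forall$; only types in which every quantified variable actually occurs in its scope are considered. Typing $\Gamma\vdash_{\mathcal F} t:A$ of pure $\lambda$-terms is given by (ax); ($\rightarrow_i$): from $\Gamma,x:B\vdash t:C$ infer $\Gamma\vdash\lambda xt:B\rightarrow C$; ($\rightarrow_e$): from $\Gamma\vdash u:B\rightarrow C$, $\Gamma\vdash v:B$ infer $\Gamma\vdash(u)v:C$; ($\forall_i$): from $\Gamma\vdash t:A$, $X$ not free in $\Gamma$, infer $\Gamma\vdash t:\forall XA$; ($\forall_e$): from $\Gamma\vdash t:\forall XA$ infer $\Gamma\vdash t:A[C/X]$ for any type $C$. $\mathcal F_0$ is the system $\mathcal F$ without the rule ($\forall_e$). A closed type $E$ is an input type iff for every $\beta$-normal $t$, $\vdash_{\mathcal F}t:E$ implies $\vdash_{\mathcal F_0}t:E$. $\forall^+$/$\forall^-$ types: a type variable is both; if $A$ is $\forall^+$ (resp. $\forall^-$) and $B$ is $\forall^-$ (resp. $\forall^+$) then $B\rightarrow A$ is $\forall^+$ (resp. $\forall^-$); if $A$ is $\forall^+$ and $X$ is free in $A$ then $\forall XA$ is $\forall^+$. -}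

module Defs where

open import Data.Nat using (ℕ; zero; suc)
open import Data.Fin using (Fin; zero; suc)
open import Data.Vec using (Vec; []; _∷_; lookup; map)
open import Relation.Nullary using (¬_)

infixr 7 _⇒_

data Ty (n : ℕ) : Set where
  tvar : Fin n → Ty n
  tcon : ℕ → Ty n
  _⇒_  : Ty n → Ty n → Ty n
  ∀'   : Ty (suc n) → Ty n    -- ∀X A, X bound as index 0

ext : ∀ {n k} → (Fin n → Fin k) → Fin (suc n) → Fin (suc k)
ext ρ zero    = zero
ext ρ (suc i) = suc (ρ i)

rename : ∀ {n k} → (Fin n → Fin k) → Ty n → Ty k
rename ρ (tvar i) = tvar (ρ i)
rename ρ (tcon c) = tcon c
rename ρ (A ⇒ B)  = rename ρ A ⇒ rename ρ B
rename ρ (∀' A)   = ∀' (rename (ext ρ) A)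

weaken : ∀ {n} → Ty n → Ty (suc n)
weaken = rename suc

exts : ∀ {n k} → (Fin n → Ty k) → Fin (suc n) → Ty (suc k)
exts σ zero    = tvar zero
exts σ (suc i) = weaken (σ i)

subst : ∀ {n k} → (Fin n → Ty k) → Ty n → Ty k
subst σ (tvar i) = σ i
subst σ (tcon c) = tcon c
subst σ (A ⇒ B)  = subst σ A ⇒ subst σ B
subst σ (∀' A)   = ∀' (subst (exts σ) A)

σ₀ : ∀ {n} → Ty n → Fin (suc n) → Ty n
σ₀ C zero    = C
σ₀ C (suc i) = tvar i

_[_] : ∀ {n} → Ty (suc n) → Ty n → Ty n
A [ C ] = subst (σ₀ C) A

data Occurs {n : ℕ} (x : Fin n) : Ty n → Set where
  here : Occurs x (tvar x)
  ⇒ˡ   : ∀ {A B} → Occurs x A → Occurs x (A ⇒ B)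
  ⇒ʳ   : ∀ {A B} → Occurs x B → Occurs x (A ⇒ B)
  under : ∀ {A} → Occurs (suc x) A → Occurs x (∀' A)

data WF {n : ℕ} : Ty n → Set where
  wf-var : ∀ {i} → WF (tvar i)
  wf-con : ∀ {c} → WF (tcon c)
  wf-⇒   : ∀ {A B} → WF A → WF B → WF (A ⇒ B)
  wf-∀   : ∀ {A} → WF A → Occurs zero A → WF (∀' A)

data Tm (m : ℕ) : Set where
  var : Fin m → Tm m
  lam : Tm (suc m) → Tm m
  app : Tm m → Tm m → Tm m

data IsLam {m : ℕ} : Tm m → Set where
  isLam : ∀ {t} → IsLam (lam t)

data BetaNormal {m : ℕ} : Tm m → Set where
  nf-var : ∀ {x} → BetaNormal (var x)
  nf-lam : ∀ {t} → BetaNormal t → BetaNormal (lam t)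
  nf-app : ∀ {u v} → ¬ IsLam u → BetaNormal u → BetaNormal v →
           BetaNormal (app u v)

-- Typing: system F and F₀ (= F without the rule ∀-elimination)

data System : Set where
  𝓕 𝓕₀ : System

Ctx : ℕ → ℕ → Set
Ctx n m = Vec (Ty n) m

data _⊢[_]_∶_ {n m : ℕ} (Γ : Ctx n m) : System → Tm m → Ty n → Set where
  ax  : ∀ {S} (x : Fin m) → Γ ⊢[ S ] var x ∶ lookup Γ x
  →i  : ∀ {S t B C} → WF B → (B ∷ Γ) ⊢[ S ] t ∶ C → Γ ⊢[ S ] lam t ∶ (B ⇒ C)
  →e  : ∀ {S u v B C} → Γ ⊢[ S ] u ∶ (B ⇒ C) → Γ ⊢[ S ] v ∶ B →
        Γ ⊢[ S ] app u v ∶ C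
  -- ∀i: X fresh for Γ is expressed by weakening Γ; the new type ∀X A
  -- must be well formed, i.e. X occurs in A
  ∀i  : ∀ {S t A} → map weaken Γ ⊢[ S ] t ∶ A → Occurs zero A →
        Γ ⊢[ S ] t ∶ ∀' A
  ∀e  : ∀ {t A} → Γ ⊢[ 𝓕 ] t ∶ ∀' A → (C : Ty n) → WF C →
        Γ ⊢[ 𝓕 ] t ∶ (A [ C ])

data Pos {n : ℕ} : Ty n → Set
data Neg {n : ℕ} : Ty n → Set

data Pos {n} where
  pos-var : ∀ {i} → Pos (tvar i)
  pos-⇒   : ∀ {A B} → Neg B → Pos A → Pos (B ⇒ A)
  pos-∀   : ∀ {A} → Pos A → Occurs zero A → Pos (∀' A)

data Neg {n} where
  neg-var : ∀ {i} → Neg (tvar i)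
  neg-⇒   : ∀ {A B} → Pos B → Neg A → Neg (B ⇒ A)

InputType : Ty 0 → Set
InputType E = (t : Tm 0) → BetaNormal t →
  [] ⊢[ 𝓕 ] t ∶ E → [] ⊢[ 𝓕₀ ] t ∶ E

module Submission where

-- Work with the ∀⁺/∀⁻ grammar without its occurrence side condition
-- (WeakPos/WeakNeg) and with contexts of WeakNeg types; the empty context is
-- one, and WeakNeg types contain no ∀ at all.  In such a context:
--   * a neutral β-normal term (not a λ) has as type a final segment of the
--     type of some hypothesis, hence a WeakNeg type and never a ∀-type
--     (`neutral-suffix`, `neutral-weakNeg`);
--   * so an 𝓕₀-derivation of t : ∀X A must end with ∀-introduction, and
--     the substitution lemma for 𝓕₀ then yields t : A[C/X] (`instantiate`);
--   * by mutual induction on 𝓕-derivations, neutral terms and terms of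
--     WeakPos type get 𝓕₀-derivations (`synth`, `check`): a ∀-elimination
--     at a WeakPos type A[C/X] comes from a WeakPos type ∀X A, which is
--     checked first and then instantiated in 𝓕₀.

open import Defs
open import Data.Nat using (ℕ; suc)
open import Data.Fin using (Fin; zero; suc)
open import Data.Fin.Properties using (suc-injective)
open import Data.Vec using ([]; _∷_; lookup; map)
open import Data.Vec.Properties using (lookup-map; map-∘; map-cong; map-id)
open import Data.Product using (Σ; _,_)
open import Relation.Nullary using (¬_)
open import Relation.Binary.PropositionalEquality
  using (_≡_; refl; sym; trans; cong; cong₂) renaming (subst to substEq)
open Relation.Binary.PropositionalEquality.≡-Reasoning

rename-cong : ∀ {n k} {ρ ρ' : Fin n → Fin k} → (∀ i → ρ i ≡ ρ' i) →
  (A : Ty n) → rename ρ A ≡ rename ρ' A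
rename-cong e (tvar i) = cong tvar (e i)
rename-cong e (tcon c) = refl
rename-cong e (A ⇒ B)  = cong₂ _⇒_ (rename-cong e A) (rename-cong e B)
rename-cong e (∀' A)   = cong ∀' (rename-cong e-ext A)
  where
  e-ext : ∀ i → ext _ i ≡ ext _ i
  e-ext zero    = refl
  e-ext (suc i) = cong suc (e i)

subst-cong : ∀ {n k} {σ τ : Fin n → Ty k} → (∀ i → σ i ≡ τ i) →
  (A : Ty n) → subst σ A ≡ subst τ A
subst-cong e (tvar i) = e i
subst-cong e (tcon c) = refl
subst-cong e (A ⇒ B)  = cong₂ _⇒_ (subst-cong e A) (subst-cong e B)
subst-cong e (∀' A)   = cong ∀' (subst-cong e-exts A)
  where
  e-exts : ∀ i → exts _ i ≡ exts _ i
  e-exts zero    = refl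
  e-exts (suc i) = cong weaken (e i)

rename-rename : ∀ {n k l} (ρ : Fin k → Fin l) (ρ' : Fin n → Fin k) (A : Ty n) →
  rename ρ (rename ρ' A) ≡ rename (λ i → ρ (ρ' i)) A
rename-rename ρ ρ' (tvar i) = refl
rename-rename ρ ρ' (tcon c) = refl
rename-rename ρ ρ' (A ⇒ B)  = cong₂ _⇒_ (rename-rename ρ ρ' A) (rename-rename ρ ρ' B)
rename-rename ρ ρ' (∀' A)   =
  cong ∀' (trans (rename-rename (ext ρ) (ext ρ') A) (rename-cong ext-fusion A))
  where
  ext-fusion : ∀ i → ext ρ (ext ρ' i) ≡ ext (λ j → ρ (ρ' j)) i
  ext-fusion zero    = refl
  ext-fusion (suc i) = refl

subst-rename : ∀ {n k l} (σ : Fin k → Ty l) (ρ : Fin n → Fin k) (A : Ty n) →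
  subst σ (rename ρ A) ≡ subst (λ i → σ (ρ i)) A
subst-rename σ ρ (tvar i) = refl
subst-rename σ ρ (tcon c) = refl
subst-rename σ ρ (A ⇒ B)  = cong₂ _⇒_ (subst-rename σ ρ A) (subst-rename σ ρ B)
subst-rename σ ρ (∀' A)   =
  cong ∀' (trans (subst-rename (exts σ) (ext ρ) A) (subst-cong exts-fusion A))
  where
  exts-fusion : ∀ i → exts σ (ext ρ i) ≡ exts (λ j → σ (ρ j)) i
  exts-fusion zero    = refl
  exts-fusion (suc i) = refl

rename-subst : ∀ {n k l} (ρ : Fin k → Fin l) (σ : Fin n → Ty k) (A : Ty n) →
  rename ρ (subst σ A) ≡ subst (λ i → rename ρ (σ i)) A
rename-subst ρ σ (tvar i) = refl
rename-subst ρ σ (tcon c) = refl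
rename-subst ρ σ (A ⇒ B)  = cong₂ _⇒_ (rename-subst ρ σ A) (rename-subst ρ σ B)
rename-subst ρ σ (∀' A)   =
  cong ∀' (trans (rename-subst (ext ρ) (exts σ) A) (subst-cong exts-fusion A))
  where
  exts-fusion : ∀ i → rename (ext ρ) (exts σ i) ≡ exts (λ j → rename ρ (σ j)) i
  exts-fusion zero    = refl
  exts-fusion (suc i) = begin
    rename (ext ρ) (rename suc (σ i)) ≡⟨ rename-rename (ext ρ) suc (σ i) ⟩
    rename (λ j → suc (ρ j)) (σ i)    ≡⟨ sym (rename-rename suc ρ (σ i)) ⟩
    rename suc (rename ρ (σ i))       ∎

subst-id : ∀ {n} {σ : Fin n → Ty n} → (∀ i → σ i ≡ tvar i) → (A : Ty n) → subst σ A ≡ A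
subst-id e (tvar i) = e i
subst-id e (tcon c) = refl
subst-id e (A ⇒ B)  = cong₂ _⇒_ (subst-id e A) (subst-id e B)
subst-id e (∀' A)   = cong ∀' (subst-id e-exts A)
  where
  e-exts : ∀ i → exts _ i ≡ tvar i
  e-exts zero    = refl
  e-exts (suc i) = cong weaken (e i)

-- Substitution under a binder commutes with weakening; needed to push a
-- substitution through ∀-introduction, whose premise has a weakened context.
subst-exts-weaken : ∀ {n k} (σ : Fin n → Ty k) (B : Ty n) →
  subst (exts σ) (weaken B) ≡ weaken (subst σ B)
subst-exts-weaken σ B = trans (subst-rename (exts σ) suc B) (sym (rename-subst suc σ B))

instantiate-weaken : ∀ {n} (C B : Ty n) → weaken B [ C ] ≡ B
instantiate-weaken C B = trans (subst-rename (σ₀ C) suc B) (subst-id (λ _ → refl) B)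

occurs-rename : ∀ {n k} (ρ : Fin n → Fin k) {x} {A : Ty n} →
  Occurs x A → Occurs (ρ x) (rename ρ A)
occurs-rename ρ here      = here
occurs-rename ρ (⇒ˡ o)    = ⇒ˡ (occurs-rename ρ o)
occurs-rename ρ (⇒ʳ o)    = ⇒ʳ (occurs-rename ρ o)
occurs-rename ρ (under o) = under (occurs-rename (ext ρ) o)

occurs-subst : ∀ {n k} (σ : Fin n → Ty k) {x y} {A : Ty n} →
  Occurs x A → Occurs y (σ x) → Occurs y (subst σ A)
occurs-subst σ here      o = o
occurs-subst σ (⇒ˡ p)    o = ⇒ˡ (occurs-subst σ p o)
occurs-subst σ (⇒ʳ p)    o = ⇒ʳ (occurs-subst σ p o)
occurs-subst σ (under p) o = under (occurs-subst (exts σ) p (occurs-rename suc o))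

occurs-rename⁻ : ∀ {n k} (ρ : Fin n → Fin k) {x} (A : Ty n) →
  Occurs x (rename ρ A) → Σ (Fin n) λ y → ρ y ≡ x
occurs-rename⁻ ρ (tvar i) here      = i , refl
occurs-rename⁻ ρ (A ⇒ B)  (⇒ˡ o)    = occurs-rename⁻ ρ A o
occurs-rename⁻ ρ (A ⇒ B)  (⇒ʳ o)    = occurs-rename⁻ ρ B o
occurs-rename⁻ ρ (∀' A)   (under o) with occurs-rename⁻ (ext ρ) A o
... | suc y , e = y , suc-injective e

fresh-not-in-weaken : ∀ {n} (B : Ty n) → ¬ Occurs zero (weaken B)
fresh-not-in-weaken B o with occurs-rename⁻ suc B o
... | _ , ()

wf-rename : ∀ {n k} (ρ : Fin n → Fin k) {A : Ty n} → WF A → WF (rename ρ A)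
wf-rename ρ wf-var     = wf-var
wf-rename ρ wf-con     = wf-con
wf-rename ρ (wf-⇒ a b) = wf-⇒ (wf-rename ρ a) (wf-rename ρ b)
wf-rename ρ (wf-∀ a o) = wf-∀ (wf-rename (ext ρ) a) (occurs-rename (ext ρ) o)

wf-subst : ∀ {n k} {σ : Fin n → Ty k} → (∀ i → WF (σ i)) → {A : Ty n} → WF A → WF (subst σ A)
wf-subst w wf-var     = w _
wf-subst w wf-con     = wf-con
wf-subst w (wf-⇒ a b) = wf-⇒ (wf-subst w a) (wf-subst w b)
wf-subst {σ = σ} w (wf-∀ a o) = wf-∀ (wf-subst wf-exts a) (occurs-subst (exts σ) o here)
  where
  wf-exts : ∀ i → WF (exts σ i)
  wf-exts zero    = wf-var
  wf-exts (suc i) = wf-rename suc (w i)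

subst-⊢₀ : ∀ {n k m} {σ : Fin n → Ty k} → (∀ i → WF (σ i)) →
  {Γ : Ctx n m} {t : Tm m} {A : Ty n} →
  Γ ⊢[ 𝓕₀ ] t ∶ A → map (subst σ) Γ ⊢[ 𝓕₀ ] t ∶ subst σ A
subst-⊢₀ {σ = σ} w {Γ} (ax x) =
  substEq (map (subst σ) Γ ⊢[ 𝓕₀ ] var x ∶_) (lookup-map x (subst σ) Γ) (ax x)
subst-⊢₀ w (→i b d) = →i (wf-subst w b) (subst-⊢₀ w d)
subst-⊢₀ w (→e d e) = →e (subst-⊢₀ w d) (subst-⊢₀ w e)
subst-⊢₀ {σ = σ} w {Γ} {t} (∀i {A = A} d o) =
  ∀i (substEq (_⊢[ 𝓕₀ ] t ∶ subst (exts σ) A) ctx-commutes (subst-⊢₀ wf-exts d))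
     (occurs-subst (exts σ) o here)
  where
  wf-exts : ∀ i → WF (exts σ i)
  wf-exts zero    = wf-var
  wf-exts (suc i) = wf-rename suc (w i)
  ctx-commutes : map (subst (exts σ)) (map weaken Γ) ≡ map weaken (map (subst σ) Γ)
  ctx-commutes = begin
    map (subst (exts σ)) (map weaken Γ) ≡⟨ sym (map-∘ (subst (exts σ)) weaken Γ) ⟩
    map (λ B → subst (exts σ) (weaken B)) Γ ≡⟨ map-cong (subst-exts-weaken σ) Γ ⟩
    map (λ B → weaken (subst σ B)) Γ ≡⟨ map-∘ weaken (subst σ) Γ ⟩
    map weaken (map (subst σ) Γ) ∎

instantiate-premise : ∀ {n m} {Γ : Ctx n m} {t : Tm m} {A : Ty (suc n)} {C : Ty n} →
  WF C → map weaken Γ ⊢[ 𝓕₀ ] t ∶ A → Γ ⊢[ 𝓕₀ ] t ∶ (A [ C ])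
instantiate-premise {Γ = Γ} {t} {A} {C} wfC d =
  substEq (_⊢[ 𝓕₀ ] t ∶ (A [ C ])) ctx-unchanged (subst-⊢₀ wf-σ₀ d)
  where
  wf-σ₀ : ∀ i → WF (σ₀ C i)
  wf-σ₀ zero    = wfC
  wf-σ₀ (suc i) = wf-var
  ctx-unchanged : map (subst (σ₀ C)) (map weaken Γ) ≡ Γ
  ctx-unchanged = begin
    map (subst (σ₀ C)) (map weaken Γ) ≡⟨ sym (map-∘ (subst (σ₀ C)) weaken Γ) ⟩
    map (λ B → weaken B [ C ]) Γ      ≡⟨ map-cong (instantiate-weaken C) Γ ⟩
    map (λ B → B) Γ                   ≡⟨ map-id Γ ⟩
    Γ                                 ∎

data WeakPos {n : ℕ} : Ty n → Set
data WeakNeg {n : ℕ} : Ty n → Set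

data WeakPos {n} where
  wpos-var : ∀ {i} → WeakPos (tvar i)
  wpos-⇒   : ∀ {A B} → WeakNeg B → WeakPos A → WeakPos (B ⇒ A)
  wpos-∀   : ∀ {A} → WeakPos A → WeakPos (∀' A)

data WeakNeg {n} where
  wneg-var : ∀ {i} → WeakNeg (tvar i)
  wneg-⇒   : ∀ {A B} → WeakPos B → WeakNeg A → WeakNeg (B ⇒ A)

pos⇒weakPos : ∀ {n} {A : Ty n} → Pos A → WeakPos A
neg⇒weakNeg : ∀ {n} {A : Ty n} → Neg A → WeakNeg A
pos⇒weakPos pos-var       = wpos-var
pos⇒weakPos (pos-⇒ b a)   = wpos-⇒ (neg⇒weakNeg b) (pos⇒weakPos a)
pos⇒weakPos (pos-∀ a _)   = wpos-∀ (pos⇒weakPos a)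
neg⇒weakNeg neg-var       = wneg-var
neg⇒weakNeg (neg-⇒ b a)   = wneg-⇒ (pos⇒weakPos b) (neg⇒weakNeg a)

weakPos-rename : ∀ {n k} (ρ : Fin n → Fin k) {A : Ty n} → WeakPos A → WeakPos (rename ρ A)
weakNeg-rename : ∀ {n k} (ρ : Fin n → Fin k) {A : Ty n} → WeakNeg A → WeakNeg (rename ρ A)
weakPos-rename ρ wpos-var     = wpos-var
weakPos-rename ρ (wpos-⇒ b a) = wpos-⇒ (weakNeg-rename ρ b) (weakPos-rename ρ a)
weakPos-rename ρ (wpos-∀ a)   = wpos-∀ (weakPos-rename (ext ρ) a)
weakNeg-rename ρ wneg-var     = wneg-var
weakNeg-rename ρ (wneg-⇒ b a) = wneg-⇒ (weakPos-rename ρ b) (weakNeg-rename ρ a)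

-- Weak polarity is reflected by substitution: polarity of A σ forces that of A.
-- (This is why the occurrence condition is dropped: it is not reflected.)
weakPos-subst⁻ : ∀ {n k} (σ : Fin n → Ty k) (A : Ty n) → WeakPos (subst σ A) → WeakPos A
weakNeg-subst⁻ : ∀ {n k} (σ : Fin n → Ty k) (A : Ty n) → WeakNeg (subst σ A) → WeakNeg A
weakPos-subst⁻ σ (tvar i) _            = wpos-var
weakPos-subst⁻ σ (B ⇒ A)  (wpos-⇒ b a) = wpos-⇒ (weakNeg-subst⁻ σ B b) (weakPos-subst⁻ σ A a)
weakPos-subst⁻ σ (∀' A)   (wpos-∀ a)   = wpos-∀ (weakPos-subst⁻ (exts σ) A a)
weakNeg-subst⁻ σ (tvar i) _            = wneg-var
weakNeg-subst⁻ σ (B ⇒ A)  (wneg-⇒ b a) = wneg-⇒ (weakPos-subst⁻ σ B b) (weakNeg-subst⁻ σ A a)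

NegCtx : ∀ {n m} → Ctx n m → Set
NegCtx {m = m} Γ = (x : Fin m) → WeakNeg (lookup Γ x)

negCtx-∷ : ∀ {n m} {B : Ty n} {Γ : Ctx n m} → WeakNeg B → NegCtx Γ → NegCtx (B ∷ Γ)
negCtx-∷ b g zero    = b
negCtx-∷ b g (suc x) = g x

negCtx-weaken : ∀ {n m} {Γ : Ctx n m} → NegCtx Γ → NegCtx (map weaken Γ)
negCtx-weaken {Γ = Γ} g x =
  substEq WeakNeg (sym (lookup-map x weaken Γ)) (weakNeg-rename suc (g x))

data Suffix {n : ℕ} (A : Ty n) : Ty n → Set where
  suffix-refl : Suffix A A
  suffix-⇒    : ∀ {B N} → Suffix A N → Suffix A (B ⇒ N)

suffix-codomain : ∀ {n} {A B N : Ty n} → Suffix (B ⇒ A) N → Suffix A N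
suffix-codomain suffix-refl  = suffix-⇒ suffix-refl
suffix-codomain (suffix-⇒ s) = suffix-⇒ (suffix-codomain s)

suffix-weakNeg : ∀ {n} {A N : Ty n} → Suffix A N → WeakNeg N → WeakNeg A
suffix-weakNeg suffix-refl  ν            = ν
suffix-weakNeg (suffix-⇒ s) (wneg-⇒ _ ν) = suffix-weakNeg s ν

suffix-occurs : ∀ {n} {A N : Ty n} {y} → Suffix A N → Occurs y A → Occurs y N
suffix-occurs suffix-refl  o = o
suffix-occurs (suffix-⇒ s) o = ⇒ʳ (suffix-occurs s o)

-- A β-normal non-abstraction x u₁ … uₖ typed in a weakly negative context
-- (in either system) has as type a final segment of the type of its head x.
-- ∀i is impossible since the bound variable would occur in a weakened
-- hypothesis; ∀e is impossible since weakly negative types have no ∀.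
neutral-suffix : ∀ {n m S} {Γ : Ctx n m} {t : Tm m} {A : Ty n} →
  NegCtx Γ → BetaNormal t → ¬ IsLam t → Γ ⊢[ S ] t ∶ A →
  Σ (Fin m) λ x → Suffix A (lookup Γ x)
neutral-suffix g nf notLam (ax x)   = x , suffix-refl
neutral-suffix g nf notLam (→i _ _) with notLam isLam
... | ()
neutral-suffix g (nf-app notLamᵤ nfᵤ _) notLam (→e d _)
  with neutral-suffix g nfᵤ notLamᵤ d
... | x , s = x , suffix-codomain s
neutral-suffix {Γ = Γ} g nf notLam (∀i d o)
  with neutral-suffix (negCtx-weaken {Γ = Γ} g) nf notLam d
... | x , s with fresh-not-in-weaken (lookup Γ x)
                   (substEq (Occurs zero) (lookup-map x weaken Γ) (suffix-occurs s o))
... | ()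
neutral-suffix g nf notLam (∀e d C _) with neutral-suffix g nf notLam d
... | x , s with suffix-weakNeg s (g x)
... | ()

neutral-weakNeg : ∀ {n m S} {Γ : Ctx n m} {t : Tm m} {A : Ty n} →
  NegCtx Γ → BetaNormal t → ¬ IsLam t → Γ ⊢[ S ] t ∶ A → WeakNeg A
neutral-weakNeg g nf notLam d with neutral-suffix g nf notLam d
... | x , s = suffix-weakNeg s (g x)

-- In a weakly negative context, an 𝓕₀-derivation of a β-normal term at a
-- ∀-type ends with ∀-introduction, so its instances are 𝓕₀-typable too.
instantiate : ∀ {n m} {Γ : Ctx n m} {t : Tm m} {A : Ty (suc n)} {C : Ty n} →
  NegCtx Γ → BetaNormal t → WF C → Γ ⊢[ 𝓕₀ ] t ∶ ∀' A → Γ ⊢[ 𝓕₀ ] t ∶ (A [ C ])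
instantiate {Γ = Γ} {t} {A} {C} g nf wfC d = go d refl
  where
  -- the ∀-type is abstracted so that every last rule can be matched on
  go : ∀ {T} → Γ ⊢[ 𝓕₀ ] t ∶ T → T ≡ ∀' A → Γ ⊢[ 𝓕₀ ] t ∶ (A [ C ])
  go (ax x) eq with substEq WeakNeg eq (g x)
  ... | ()
  go (→e d' e) eq with substEq WeakNeg eq (neutral-weakNeg g nf (λ ()) (→e d' e))
  ... | ()
  go (∀i d' _) refl = instantiate-premise wfC d'

synth : ∀ {n m S} {Γ : Ctx n m} {t : Tm m} {A : Ty n} →
  NegCtx Γ → BetaNormal t → ¬ IsLam t → Γ ⊢[ S ] t ∶ A → Γ ⊢[ 𝓕₀ ] t ∶ A
check : ∀ {n m S} {Γ : Ctx n m} {t : Tm m} {A : Ty n} →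
  NegCtx Γ → BetaNormal t → WeakPos A → Γ ⊢[ S ] t ∶ A → Γ ⊢[ 𝓕₀ ] t ∶ A

synth g nf notLam (ax x) = ax x
synth g nf notLam (→i _ _) with notLam isLam
... | ()
synth g (nf-app notLamᵤ nfᵤ nfᵥ) notLam (→e d e)
  with neutral-weakNeg g nfᵤ notLamᵤ d
... | wneg-⇒ posB _ = →e (synth g nfᵤ notLamᵤ d) (check g nfᵥ posB e)
synth g nf notLam d@(∀i _ _) with neutral-weakNeg g nf notLam d
... | ()
synth g nf notLam (∀e d _ _) with neutral-weakNeg g nf notLam d
... | ()

check g nf posA (ax x) = ax x
check g (nf-lam nf) (wpos-⇒ negB posA) (→i wfB d) = →i wfB (check (negCtx-∷ negB g) nf posA d)
check g nf posA d@(→e _ _) = synth g nf (λ ()) d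
check {Γ = Γ} g nf (wpos-∀ posA) (∀i d o) = ∀i (check (negCtx-weaken {Γ = Γ} g) nf posA d) o
check g nf posA[C] (∀e {A = A} d C wfC) =
  instantiate g nf wfC (check g nf (wpos-∀ (weakPos-subst⁻ (σ₀ C) A posA[C])) d)

theorem2p2p3 : (A : Ty 0) → Pos A → InputType A
theorem2p2p3 A posA t nf d = check emptyCtx-negative nf (pos⇒weakPos posA) d
  where
  emptyCtx-negative : NegCtx []
  emptyCtx-negative ()
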